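{- Let $\varepsilon\ge0$ and let $\phi_v$ ($v\in V$) be the final values computed by Algorithm A (described in the context) at the end of the stream. Then $y_v:=(1+\varepsilon)\phi_v$ is a feasible solution of the dual linear program: $y_v\ge0$ for all $v\in V$ and $y_u+y_v\ge w_{\{u,v\}}$ for all $\{u,v\}\in E$.
   Context: $G=(V,E,w)$ is a simple graph with positive edge weights, whose edges arrive in a stream in arbitrary order. Algorithm A with parameter $\varepsilon$: initialize an empty stack $S$ and $\phi_v=0$ for every vertex $v$. For each edge $e=\{u,v\}$ in stream order: if $w_e<(1+\varepsilon)(\phi_u+\phi_v)$, skip $e$; otherwise set $w'_e=w_e-(\phi_u+\phi_v)$, then $\phi_u\leftarrow\phi_u+w'_e$, $\phi_v\leftarrow\phi_v+w'_e$, and push $e$ onto $S$. The dual LP referred to is the dual of the matching LP relaxation (maximize $\sum_e w_ex_e$ s.t. $\sum_{e\ni v}x_e\le1$, $x\ge0$): minimize $\sum_v y_v$ subject to $y_u+y_v\ge w_{\{u,v\}}$ for each edge and $y\ge0$.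
   Formalization: The parameter ε and the edge weights are rational, so the potentials φ_v computed by Algorithm A are rational as well. -}

module Defs where

open import Data.Nat using (ℕ)
open import Data.Fin using (Fin; _≟_)
open import Data.Rational using (ℚ; _+_; _-_; _*_; _<_; 0ℚ; 1ℚ)
open import Data.Rational.Properties using (_<?_)
open import Data.List using (List; []; _∷_; foldl)
open import Data.List.Relation.Unary.Unique.Propositional using (Unique)
open import Data.List using (map)
open import Data.Product using (_×_; _,_)
open import Relation.Nullary using (¬_; yes; no)
open import Relation.Nullary.Decidable using (⌊_⌋)
open import Data.Bool using (_∨_; if_then_else_)
open import Relation.Binary.PropositionalEquality using (_≡_)
open import Data.Sum using (_⊎_)
open import Data.List.Membership.Propositional using (_∈_)

record Edge (n : ℕ) : Set where
  constructor edge
  field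
    u : Fin n
    v : Fin n
    w : ℚ
open Edge public

SameEndpoints : ∀ {n} → Edge n → Edge n → Set
SameEndpoints e f = ((u e ≡ u f) × (v e ≡ v f)) ⊎ ((u e ≡ v f) × (v e ≡ u f))

data DistinctPairs {n : ℕ} : List (Edge n) → Set where
  []  : DistinctPairs []
  _∷_ : ∀ {e es} → (∀ f → f ∈ es → ¬ SameEndpoints e f)
        → DistinctPairs es → DistinctPairs (e ∷ es)

record SimpleStream {n : ℕ} (es : List (Edge n)) : Set where
  field
    noLoops     : ∀ e → e ∈ es → ¬ (u e ≡ v e)
    posWeights  : ∀ e → e ∈ es → 0ℚ < w e
    simple      : DistinctPairs es

record State (n : ℕ) : Set where
  constructor state
  field
    φ     : Fin n → ℚ
    stack : List (Edge n)
open State public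

initState : ∀ {n} → State n
initState = state (λ _ → 0ℚ) []

step : ∀ {n} → ℚ → State n → Edge n → State n
step ε (state φ S) e with w e <? ((1ℚ + ε) * (φ (u e) + φ (v e)))
... | yes _ = state φ S
... | no  _ = state φ' (e ∷ S)
  where
    w' : ℚ
    w' = w e - (φ (u e) + φ (v e))
    φ' : _ → ℚ
    φ' x = if ⌊ x ≟ u e ⌋ ∨ ⌊ x ≟ v e ⌋ then φ x + w' else φ x

runA : ∀ {n} → ℚ → List (Edge n) → State n
runA ε es = foldl (step ε) initState es

finalφ : ∀ {n} → ℚ → List (Edge n) → Fin n → ℚ
finalφ ε es = φ (runA ε es)

{-# OPTIONS --safe #-}
module Submission where

open import Defs
open import Data.Nat using (ℕ)
open import Data.Fin using (Fin; _≟_)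
open import Data.Rational using (ℚ; _+_; _*_; _≤_; 0ℚ; 1ℚ; _-_; -_; nonNegative)
open import Data.Rational.Properties hiding (_≟_)
open import Data.Rational.Solver using (module +-*-Solver)
open import Data.List using (List; []; _∷_; foldl)
open import Data.List.Membership.Propositional using (_∈_)
open import Data.List.Relation.Unary.Any using (here; there)
open import Data.Product using (_×_; _,_)
open import Data.Bool using (_∨_; if_then_else_; true; false)
open import Relation.Nullary using (yes; no; contradiction)
open import Relation.Nullary.Decidable using (⌊_⌋)
open import Relation.Binary.PropositionalEquality using (_≡_; refl; sym; cong₂)

-- For nonnegative potentials, accepting e means w_e ≥ (1+ε)(φ_u + φ_v) ≥ φ_u + φ_v,
-- so the increment w'_e = w_e - (φ_u + φ_v) is nonnegative: potentials start at 0
-- and never decrease.  Right after e is read, w_e ≤ (1+ε)(φ_u + φ_v): for a skipped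
-- edge this is the skipping test, for an accepted one φ_u + φ_v becomes
-- w_e + w'_e ≥ w_e.  As potentials only grow, this persists to the end of the stream.

p≤p+q : ∀ p {q} → 0ℚ ≤ q → p ≤ p + q
p≤p+q p {q} 0≤q = begin
  p      ≡⟨ sym (+-identityʳ p) ⟩
  p + 0ℚ ≤⟨ +-monoʳ-≤ p 0≤q ⟩
  p + q  ∎
  where open ≤-Reasoning

p≤q⇒0≤q-p : ∀ {p q} → p ≤ q → 0ℚ ≤ q - p
p≤q⇒0≤q-p {p} {q} p≤q = begin
  0ℚ     ≡⟨ sym (+-inverseʳ p) ⟩
  p - p  ≤⟨ +-monoˡ-≤ (- p) p≤q ⟩
  q - p  ∎
  where open ≤-Reasoning

p≤[1+q]*p : ∀ {p q} → 0ℚ ≤ q → 0ℚ ≤ p → p ≤ (1ℚ + q) * p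
p≤[1+q]*p {p} {q} 0≤q 0≤p = begin
  p                 ≤⟨ p≤p+q p 0≤qp ⟩
  p + q * p         ≡⟨ cong₂ _+_ (sym (*-identityˡ p)) refl ⟩
  1ℚ * p + q * p    ≡⟨ sym (*-distribʳ-+ p 1ℚ q) ⟩
  (1ℚ + q) * p      ∎
  where
  open ≤-Reasoning
  0≤qp : 0ℚ ≤ q * p
  0≤qp = nonNegative⁻¹ _ {{nonNeg*nonNeg⇒nonNeg q {{nonNegative 0≤q}} p {{nonNegative 0≤p}}}}

a+[w-[a+b]]+b+[w-[a+b]]≡w+[w-[a+b]] : ∀ a b w →
  (a + (w - (a + b))) + (b + (w - (a + b))) ≡ w + (w - (a + b))
a+[w-[a+b]]+b+[w-[a+b]]≡w+[w-[a+b]] = solve 3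
  (λ a b w → (a :+ (w :- (a :+ b))) :+ (b :+ (w :- (a :+ b)))
             := w :+ (w :- (a :+ b)))
  refl
  where open +-*-Solver

module _ {n : ℕ} where

  -- Definitionally the potentials that step produces when it accepts an edge {a, b} with increment d.
  raise : (Fin n → ℚ) → Fin n → Fin n → ℚ → Fin n → ℚ
  raise f a b d x = if ⌊ x ≟ a ⌋ ∨ ⌊ x ≟ b ⌋ then f x + d else f x

  raise-≥ : ∀ f a b {d} → 0ℚ ≤ d → ∀ x → f x ≤ raise f a b d x
  raise-≥ f a b {d} 0≤d x with ⌊ x ≟ a ⌋ ∨ ⌊ x ≟ b ⌋
  ... | true  = p≤p+q (f x) 0≤d
  ... | false = ≤-refl

  raise-at-left : ∀ f a b d → raise f a b d a ≡ f a + d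
  raise-at-left f a b d with a ≟ a
  ... | yes _   = refl
  ... | no a≢a = contradiction refl a≢a

  raise-at-right : ∀ f a b d → raise f a b d b ≡ f b + d
  raise-at-right f a b d with b ≟ a | b ≟ b
  ... | yes _ | _       = refl
  ... | no _  | yes _   = refl
  ... | no _  | no b≢b = contradiction refl b≢b

  Nonneg : (Fin n → ℚ) → Set
  Nonneg f = ∀ x → 0ℚ ≤ f x

  _≤ᵖ_ : (Fin n → ℚ) → (Fin n → ℚ) → Set
  f ≤ᵖ g = ∀ x → f x ≤ g x

  ≤ᵖ-trans : ∀ {f g h} → f ≤ᵖ g → g ≤ᵖ h → f ≤ᵖ h
  ≤ᵖ-trans f≤g g≤h x = ≤-trans (f≤g x) (g≤h x)

  Nonneg-mono : ∀ {f g} → f ≤ᵖ g → Nonneg f → Nonneg g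
  Nonneg-mono f≤g 0≤f x = ≤-trans (0≤f x) (f≤g x)

module _ {n : ℕ} {ε : ℚ} (0≤ε : 0ℚ ≤ ε) where

  Covered : (Fin n → ℚ) → Edge n → Set
  Covered f e = w e ≤ (1ℚ + ε) * (f (u e) + f (v e))

  0≤1+ε : 0ℚ ≤ 1ℚ + ε
  0≤1+ε = ≤-trans (nonNegative⁻¹ 1ℚ) (p≤p+q 1ℚ 0≤ε)

  [1+ε]*-mono-≤ : ∀ {p q} → p ≤ q → (1ℚ + ε) * p ≤ (1ℚ + ε) * q
  [1+ε]*-mono-≤ = *-monoˡ-≤-nonNeg (1ℚ + ε) {{nonNegative 0≤1+ε}}

  Covered-mono : ∀ {f g} e → f ≤ᵖ g → Covered f e → Covered g e
  Covered-mono e f≤g cov =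
    ≤-trans cov ([1+ε]*-mono-≤ (+-mono-≤ (f≤g (u e)) (f≤g (v e))))

  increment-nonneg : ∀ {f} (e : Edge n) → Nonneg f → (1ℚ + ε) * (f (u e) + f (v e)) ≤ w e →
                     0ℚ ≤ w e - (f (u e) + f (v e))
  increment-nonneg {f} e 0≤f accepted = p≤q⇒0≤q-p (≤-trans
    (p≤[1+q]*p 0≤ε (+-mono-≤ (0≤f (u e)) (0≤f (v e)))) accepted)

  step-≥ : ∀ s e → Nonneg (φ s) → φ s ≤ᵖ φ (step ε s e)
  step-≥ s e 0≤φ with w e <? (1ℚ + ε) * (φ s (u e) + φ s (v e))
  ... | yes _ = λ _ → ≤-refl
  ... | no ¬< = raise-≥ (φ s) (u e) (v e) (increment-nonneg e 0≤φ (≮⇒≥ ¬<))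

  step-nonneg : ∀ s e → Nonneg (φ s) → Nonneg (φ (step ε s e))
  step-nonneg s e 0≤φ = Nonneg-mono (step-≥ s e 0≤φ) 0≤φ

  step-covers : ∀ s e → Nonneg (φ s) → Covered (φ (step ε s e)) e
  step-covers s e 0≤φ with w e <? (1ℚ + ε) * (φ s (u e) + φ s (v e))
  ... | yes skipped = <⇒≤ skipped
  ... | no ¬<       = begin
    w e                                 ≤⟨ p≤p+q (w e) 0≤d ⟩
    w e + d                             ≡⟨ sym (a+[w-[a+b]]+b+[w-[a+b]]≡w+[w-[a+b]] (f a) (f b) (w e)) ⟩
    (f a + d) + (f b + d)               ≡⟨ sym (cong₂ _+_ (raise-at-left f a b d) (raise-at-right f a b d)) ⟩
    raise f a b d a + raise f a b d b   ≤⟨ p≤[1+q]*p 0≤ε (+-mono-≤ (0≤raise a) (0≤raise b)) ⟩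
    (1ℚ + ε) * (raise f a b d a + raise f a b d b) ∎
    where
    open ≤-Reasoning
    f : Fin n → ℚ
    f = φ s
    a b : Fin n
    a = u e
    b = v e
    d : ℚ
    d = w e - (f a + f b)
    0≤d : 0ℚ ≤ d
    0≤d = increment-nonneg e 0≤φ (≮⇒≥ ¬<)
    0≤raise : Nonneg (raise f a b d)
    0≤raise = Nonneg-mono (raise-≥ f a b 0≤d) 0≤φ

  steps-≥ : ∀ es s → Nonneg (φ s) → φ s ≤ᵖ φ (foldl (step ε) s es)
  steps-≥ []       s 0≤φ = λ _ → ≤-refl
  steps-≥ (e ∷ es) s 0≤φ =
    ≤ᵖ-trans (step-≥ s e 0≤φ) (steps-≥ es (step ε s e) (step-nonneg s e 0≤φ))

  steps-cover : ∀ es s → Nonneg (φ s) → ∀ {e} → e ∈ es → Covered (φ (foldl (step ε) s es)) e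
  steps-cover (e ∷ es) s 0≤φ (here refl) =
    Covered-mono e (steps-≥ es (step ε s e) (step-nonneg s e 0≤φ)) (step-covers s e 0≤φ)
  steps-cover (e ∷ es) s 0≤φ (there e∈es) =
    steps-cover es (step ε s e) (step-nonneg s e 0≤φ) e∈es

mainTheorem7 : (n : ℕ) (ε : ℚ) (es : List (Edge n)) → SimpleStream es → 0ℚ ≤ ε →
    let y = λ (x : Fin n) → (1ℚ + ε) * finalφ ε es x in
    (∀ (x : Fin n) → 0ℚ ≤ y x) ×
    (∀ (e : Edge n) → e ∈ es → w e ≤ y (u e) + y (v e))
mainTheorem7 n ε es _ 0≤ε = y-nonneg , y-feasible
  where
  0≤φ₀ : Nonneg (φ (initState {n}))
  0≤φ₀ _ = ≤-refl
  0≤φ : Nonneg (finalφ ε es)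
  0≤φ = Nonneg-mono (steps-≥ 0≤ε es initState 0≤φ₀) 0≤φ₀
  y-nonneg : ∀ x → 0ℚ ≤ (1ℚ + ε) * finalφ ε es x
  y-nonneg x = ≤-trans (0≤φ x) (p≤[1+q]*p 0≤ε (0≤φ x))
  y-feasible : ∀ e → e ∈ es → w e ≤ (1ℚ + ε) * finalφ ε es (u e) + (1ℚ + ε) * finalφ ε es (v e)
  y-feasible e e∈es = ≤-trans (steps-cover 0≤ε es initState 0≤φ₀ e∈es)
                              (≤-reflexive (*-distribˡ-+ (1ℚ + ε) _ _))
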